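{- Let $x:\mathbb{R}_D$ and suppose $\exists_{s:\mathbb{Q}}\,(x=i(s))$, where $i:\mathbb{Q}\to\mathbb{R}_D$ is the canonical embedding. Then $x$ has a locator, i.e. one can construct an element of $\operatorname{locator}(x)$.
   Context: Work in Martin-Löf type theory with propositional truncation, function extensionality and propositional extensionality. A Dedekind real is a pair $x=(L,U)$ of proposition-valued predicates on $\mathbb{Q}$; write $q<x$ for $q\in L$ and $x<r$ for $r\in U$; it is required to be bounded, rounded, transitive ($q<x\land x<r\Rightarrow q<r$) and located ($q<r\Rightarrow (q<x)\lor(x<r)$, with $\lor$ the truncated sum). $\mathbb{R}_D$ is the type of Dedekind reals; the embedding $i(s)$ of a rational $s$ has lower cut $\{q: q<s\}$ and upper cut $\{r: s<r\}$. A locator for $x$ is a function $\prod_{q,r:\mathbb{Q}}(q<r)\to(q<x)+(x<r)$ (untruncated disjoint sum); $\operatorname{locator}(x)$ is the type of these. -}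

module Defs where

open import Level using (Level; _⊔_; 0ℓ; Setω) renaming (suc to lsuc)
open import Data.Rational using (ℚ; _<_; _+_; _-_; -_; 0ℚ; 1ℚ)
open import Data.Rational.Properties as ℚP
  using (<-trans; <-irrelevant; <-dense; _<?_; ≮⇒≥; <-≤-trans; +-monoʳ-<; +-identityʳ)
open import Data.Product using (Σ; _×_; _,_; proj₁; proj₂)
open import Data.Sum using (_⊎_; inj₁; inj₂)
open import Relation.Nullary using (yes; no)
open import Relation.Binary.PropositionalEquality using (_≡_; subst; sym)

-- Univalent-foundations ambient structure (not built into --safe Agda
-- without cubical): mere propositions, and propositional truncation,
-- function extensionality and propositional extensionality, provided
-- as explicit hypotheses.

isProp : {ℓ : Level} → Set ℓ → Set ℓ
isProp A = (a b : A) → a ≡ b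

record Truncation : Setω where
  field
    ∥_∥      : {ℓ : Level} → Set ℓ → Set ℓ
    ∣_∣      : {ℓ : Level} {A : Set ℓ} → A → ∥ A ∥
    ∥∥-isProp : {ℓ : Level} {A : Set ℓ} → isProp ∥ A ∥
    ∥∥-rec   : {ℓ ℓ' : Level} {A : Set ℓ} {B : Set ℓ'} →
               isProp B → (A → B) → ∥ A ∥ → B

FunExt : Setω
FunExt = {a b : Level} {A : Set a} {B : A → Set b} {f g : (x : A) → B x} →
         ((x : A) → f x ≡ g x) → f ≡ g

PropExt : Setω
PropExt = {ℓ : Level} {P Q : Set ℓ} → isProp P → isProp Q →
          (P → Q) → (Q → P) → P ≡ Q

module Dedekind (T : Truncation) where
  open Truncation T public

  ∃∥ : {A : Set} → (A → Set) → Set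
  ∃∥ {A} P = ∥ Σ A P ∥

  _∨_ : Set → Set → Set
  P ∨ Q = ∥ P ⊎ Q ∥

  record ℝD : Set₁ where
    field
      lower : ℚ → Set          -- q ∈ L  means  q < x
      upper : ℚ → Set          -- r ∈ U  means  x < r
      lower-prop : (q : ℚ) → isProp (lower q)
      upper-prop : (r : ℚ) → isProp (upper r)
      lower-inhabited : ∃∥ (λ q → lower q)
      upper-inhabited : ∃∥ (λ r → upper r)
      lower-rounded-→ : (q : ℚ) → lower q → ∃∥ (λ q' → (q < q') × lower q')
      lower-rounded-← : (q : ℚ) → ∃∥ (λ q' → (q < q') × lower q') → lower q
      upper-rounded-→ : (r : ℚ) → upper r → ∃∥ (λ r' → (r' < r) × upper r')
      upper-rounded-← : (r : ℚ) → ∃∥ (λ r' → (r' < r) × upper r') → upper r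
      transitive : (q r : ℚ) → lower q → upper r → q < r
      located : (q r : ℚ) → q < r → lower q ∨ upper r

  open ℝD public

  _<ₗ_ : ℚ → ℝD → Set
  q <ₗ x = lower x q

  _<ᵤ_ : ℝD → ℚ → Set
  x <ᵤ r = upper x r

  locator : ℝD → Set
  locator x = (q r : ℚ) → q < r → (q <ₗ x) ⊎ (x <ᵤ r)

  private
    s-1<s : (s : ℚ) → s - 1ℚ < s
    s-1<s s = subst (s - 1ℚ <_) (+-identityʳ s)
                (+-monoʳ-< s (ℚP.negative⁻¹ (- 1ℚ)))

    s<s+1 : (s : ℚ) → s < s + 1ℚ
    s<s+1 s = subst (_< s + 1ℚ) (+-identityʳ s)
                (+-monoʳ-< s (ℚP.positive⁻¹ 1ℚ))

  i : ℚ → ℝD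
  i s = record
    { lower = λ q → q < s
    ; upper = λ r → s < r
    ; lower-prop = λ q → <-irrelevant
    ; upper-prop = λ r → <-irrelevant
    ; lower-inhabited = ∣ (s - 1ℚ , s-1<s s) ∣
    ; upper-inhabited = ∣ (s + 1ℚ , s<s+1 s) ∣
    ; lower-rounded-→ = λ q q<s → let (m , q<m , m<s) = <-dense q<s in ∣ (m , q<m , m<s) ∣
    ; lower-rounded-← = λ q → ∥∥-rec <-irrelevant (λ { (q' , q<q' , q'<s) → <-trans q<q' q'<s })
    ; upper-rounded-→ = λ r s<r → let (m , s<m , m<r) = <-dense s<r in ∣ (m , m<r , s<m) ∣
    ; upper-rounded-← = λ r → ∥∥-rec <-irrelevant (λ { (r' , r'<r , s<r') → <-trans s<r' r'<r })
    ; transitive = λ q r q<s s<r → <-trans q<s s<r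
    ; located = λ q r q<r → ∣ dec q r q<r ∣
    }
    where
      dec : (q r : ℚ) → q < r → (q < s) ⊎ (s < r)
      dec q r q<r with q <? s
      ... | yes q<s = inj₁ q<s
      ... | no q≮s = inj₂ (ℚP.≤-<-trans (≮⇒≥ q≮s) q<r)

-- The difficulty is that the hypothesis ∥ Σ s , x ≡ i s ∥ is truncated,
-- while a locator produces untruncated disjunctions, so we cannot simply
-- extract the rational s.  The proof routes through decidability:
--
--   * Dec P is a proposition whenever P is (using function extensionality),
--     so decidability of a cut can be extracted from a truncated witness.
--   * Every lower cut of i s is decidable (by q <? s), hence, by transport
--     along x ≡ i s and truncation elimination, so is every lower cut of x.
--   * A real with decidable lower cut has a locator: given q < r, decide
--     q < x; if it fails, locatedness (q < x) ∨ (x < r) leaves only x < r,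
--     and x < r is a proposition, so it can be taken out of the truncation.

module Submission where

open import Defs
open import Level using (Level)
open import Data.Rational using (ℚ; _<_)
open import Data.Rational.Properties using (_<?_)
open import Data.Product using (Σ; _,_)
open import Data.Sum using (_⊎_; inj₁; inj₂)
open import Data.Empty using (⊥-elim)
open import Relation.Nullary using (Dec; yes; no)
open import Relation.Binary.PropositionalEquality using (_≡_; cong; subst; sym)

Dec-isProp : FunExt → {ℓ : Level} {P : Set ℓ} → isProp P → isProp (Dec P)
Dec-isProp fe P-prop (yes p) (yes p′) = cong yes (P-prop p p′)
Dec-isProp fe P-prop (yes p) (no ¬p)  = ⊥-elim (¬p p)
Dec-isProp fe P-prop (no ¬p) (yes p)  = ⊥-elim (¬p p)
Dec-isProp fe P-prop (no ¬p) (no ¬p′) = cong no (fe (λ p → ⊥-elim (¬p p)))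

module _ (T : Truncation) where
  open Dedekind T

  DecidableLower : ℝD → Set
  DecidableLower x = (q : ℚ) → Dec (q <ₗ x)

  -- A real with decidable lower cut has a locator: when q < x fails,
  -- locatedness forces x < r, which is a proposition and so can be
  -- extracted from the truncated disjunction.
  decidableLower⇒locator : (x : ℝD) → DecidableLower x → locator x
  decidableLower⇒locator x dec q r q<r with dec q
  ... | yes q<x = inj₁ q<x
  ... | no q≮x  = inj₂ (∥∥-rec (upper-prop x r) upper-only (located x q r q<r))
    where
      upper-only : (q <ₗ x) ⊎ (x <ᵤ r) → x <ᵤ r
      upper-only (inj₁ q<x) = ⊥-elim (q≮x q<x)
      upper-only (inj₂ x<r) = x<r

  -- A real merely equal to a rational has decidable lower cut: for i s the
  -- cut q < s is decided by comparison of rationals, and since deciding a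
  -- proposition is a proposition the truncated equation may be eliminated.
  rational⇒decidableLower : FunExt → (x : ℝD) →
    ∥ Σ ℚ (λ s → x ≡ i s) ∥ → DecidableLower x
  rational⇒decidableLower fe x x-rational q =
    ∥∥-rec (Dec-isProp fe (lower-prop x q)) decide-via x-rational
    where
      decide-via : Σ ℚ (λ s → x ≡ i s) → Dec (q <ₗ x)
      decide-via (s , x≡is) = subst (λ y → Dec (q <ₗ y)) (sym x≡is) (q <? s)

lemma3p7 : (T : Truncation) → FunExt → PropExt →
    let open Dedekind T in
    (x : ℝD) → ∥ Σ ℚ (λ s → x ≡ i s) ∥ → locator x
lemma3p7 T fe _ x x-rational =
  decidableLower⇒locator T x (rational⇒decidableLower T fe x x-rational)
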